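{- Let \(u \in \mathbb{Z}\) and \(k \in \mathbb{Z}_{>0}\). Define \[ \mathcal{P}_{k,u} = \left\{ (\boldsymbol{\lambda}, \mathrm{fs}_{u}(\boldsymbol{\lambda})) : \boldsymbol{\lambda} \text{ is a \(k\)-tuple of partitions} \right\}, \] and \[ \mathcal{A}_{k,u} = \left\{ (f_i)_{i \in \mathbb{Z}} : f_i + f_{i+1} \leq k \text{ for all } i \in \mathbb{Z}, \text{ and } f_i=0 \text{ for all } i<u \right\}. \] Then the map \(\Lambda\) induces a bijection between the sets \(\mathcal{P}_{k,u}\) and \(\mathcal{A}_{k,u}\).
   Context: A partition is a finite non-increasing sequence of non-negative integers; a generalised frequency sequence is a sequence \((f_i)_{i\in\mathbb{Z}}\) of non-negative integers with only finitely many non-zero entries, of weight \(|f|=\sum_i i f_i\). Particle motion: let \(f\) be a generalised frequency sequence and \(u\) an index with \(h:=f_u+f_{u+1}\) such that \(f_v+f_{v+1}\le h\) for all \(v\ge u\). If \(f_{u+1}+f_{u+2}<h\), replace \((f_u,f_{u+1})\) by \((f_u-1,f_{u+1}+1)\) and keep the focus at \(u\) (a particle motion, increasing the weight by 1); if \(f_{u+1}+f_{u+2}=h\), leave \(f\) unchanged and move the focus to \(u+1\) (a focus shift). \(\mathrm{pm}_u^{(m)}(f)\) denotes the sequence obtained after \(m\) particle motions (not counting focus shifts) starting from index \(u\). For \(u\in\mathbb{Z}\) and a \(k\)-tuple \(\boldsymbol{\lambda}=(\lambda^{(1)},\dots,\lambda^{(k)})\) of partitions into non-negative parts, where \(\lambda^{(i)}\)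 has \(s_i-s_{i+1}\) parts (\(s_{k+1}:=0\)), the \(u\)-frame sequence is \[ \mathrm{fs}_{u}(\boldsymbol{\lambda}) = (\cdots, 0, \underbrace{ f_{u}=k,f_{u+1}=0,\dots,k,0}_{s_k ~\text{pairs}},\dots,\underbrace{i,0,\dots,i,0}_{s_i - s_{i+1} ~\text{pairs}},\dots,\underbrace{1,0,\dots,1,0}_{s_1 - s_2 ~\text{pairs}},0, \dots ), \] of weight \(s_1^2+\dots+s_k^2+(u-1)(s_1+\dots+s_k)\). Writing \(\ell=s_1\) for the total length and renaming the parts as \((\lambda_{\ell-1},\dots,\lambda_1,\lambda_0) := (\lambda_1^{(1)},\dots,\lambda_{\ell_1}^{(1)},\dots,\lambda_{1}^{(k)},\dots,\lambda_{\ell_k}^{(k)})\) (where \(\ell_i\) is the length of \(\lambda^{(i)}\)), the map \(\Lambda\) is defined by \[ \Lambda(\boldsymbol{\lambda}, \mathrm{fs}_u(\boldsymbol{\lambda})) = \left(\mathrm{pm}_{u}^{(\lambda_0)} \circ \mathrm{pm}_{u+2}^{(\lambda_1)} \circ \cdots \circ \mathrm{pm}_{u+2\ell-2}^{(\lambda_{\ell-1})}\right)(\mathrm{fs}_u(\boldsymbol{\lambda})), \] i.e. for each \(i\), \(\lambda_i\) particle motions are applied at index \(u+2i\), starting with \(i=\ell-1\) and ending with \(i=0\). -}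

module Defs where

open import Data.Nat as ℕ using (ℕ; zero; suc; _∸_)
open import Data.Integer as ℤ using (ℤ; +_; -[1+_])
open import Data.List using (List; []; _∷_; _++_; concat; replicate; length; reverse)
open import Data.List.Relation.Unary.Linked using (Linked)
open import Data.List.Relation.Unary.All using (All)
open import Data.Vec using (Vec; []; _∷_; toList)
open import Data.Product using (∃; _×_)
open import Relation.Nullary using (yes; no)
open import Relation.Binary.PropositionalEquality using (_≡_)

-- A generalised frequency sequence (f_i)_{i ∈ ℤ}, as a function ℤ → ℕ.
-- (Finiteness of the support is imposed where needed, see FiniteSupport.)
Seq : Set
Seq = ℤ → ℕ

FiniteSupport : Seq → Set
FiniteSupport f = ∃ λ (N : ℕ) → ∀ (i : ℤ) → ℤ.∣ i ∣ ℕ.≥ N → f i ≡ 0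

IsPartition : List ℕ → Set
IsPartition = Linked ℕ._≥_

-- A k-tuple of partitions (λ^(1), …, λ^(k)); vector position 0 is λ^(1).
Tuple : ℕ → Set
Tuple k = Vec (List ℕ) k

IsTuple : ∀ {k} → Tuple k → Set
IsTuple {k} ls = Data.Vec.Relation.Unary.All.All IsPartition ls
  where import Data.Vec.Relation.Unary.All

at : List ℕ → ℕ → ℕ
at []       _       = 0
at (x ∷ _)  zero    = x
at (_ ∷ xs) (suc n) = at xs n

pairs : ℕ → ℕ → List ℕ
pairs c n = concat (replicate n (c ∷ 0 ∷ []))

-- entries of the frame sequence from index u on: blocks for i = k, k-1, …, 1,
-- the block for i consisting of (length λ^(i)) = s_i - s_{i+1} pairs "i,0".
frameListFrom : ∀ {n} → ℕ → Vec (List ℕ) n → List ℕ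
frameListFrom j []       = []
frameListFrom j (x ∷ xs) = frameListFrom (suc j) xs ++ pairs (suc j) (length x)

frameList : ∀ {k} → Tuple k → List ℕ
frameList ls = frameListFrom 0 ls

fs : ∀ {k} → ℤ → Tuple k → Seq
fs u ls i with i ℤ.- u
... | + n      = at (frameList ls) n
... | -[1+ _ ] = 0

-- the parts (λ_{ℓ-1}, …, λ_1, λ_0) = λ^(1) ++ … ++ λ^(k); reversed gives (λ_0, …, λ_{ℓ-1})
flatParts : ∀ {k} → Tuple k → List ℕ
flatParts ls = concat (toList ls)

moveAt : ℤ → Seq → Seq
moveAt u f i with i ℤ.≟ u | i ℤ.≟ (u ℤ.+ + 1)
... | yes _ | _     = f u ∸ 1
... | no _  | yes _ = suc (f (u ℤ.+ + 1))
... | no _  | no _  = f i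

Admissible : ℤ → Seq → Set
Admissible u f = ∀ (v : ℤ) → u ℤ.≤ v → f v ℕ.+ f (v ℤ.+ + 1) ℕ.≤ f u ℕ.+ f (u ℤ.+ + 1)

-- PM u m f g : g = pm_u^(m)(f), the result of m particle motions (focus shifts
-- not counted) starting with focus u, following the process literally.
data PM : ℤ → ℕ → Seq → Seq → Set where
  pm-done  : ∀ {u f} → PM u 0 f f
  pm-move  : ∀ {u m f g} → Admissible u f →
             f (u ℤ.+ + 1) ℕ.+ f (u ℤ.+ + 2) ℕ.< f u ℕ.+ f (u ℤ.+ + 1) →
             PM u m (moveAt u f) g → PM u (suc m) f g
  pm-shift : ∀ {u m f g} → Admissible u f →
             f (u ℤ.+ + 1) ℕ.+ f (u ℤ.+ + 2) ≡ f u ℕ.+ f (u ℤ.+ + 1) →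
             PM (u ℤ.+ + 1) (suc m) f g → PM u (suc m) f g

-- ApplyAll u (λ_0 ∷ λ_1 ∷ … ∷ λ_{ℓ-1} ∷ []) f g :
--   g = (pm_u^(λ_0) ∘ pm_{u+2}^(λ_1) ∘ ⋯ ∘ pm_{u+2ℓ-2}^(λ_{ℓ-1})) f
data ApplyAll : ℤ → List ℕ → Seq → Seq → Set where
  aa-nil  : ∀ {u f} → ApplyAll u [] f f
  aa-cons : ∀ {u x xs f g h} → ApplyAll (u ℤ.+ + 2) xs f g → PM u x g h →
            ApplyAll u (x ∷ xs) f h

ΛRel : ∀ {k} → ℤ → Tuple k → Seq → Set
ΛRel u ls g = ApplyAll u (reverse (flatParts ls)) (fs u ls) g

-- membership in 𝒜_{k,u} (as generalised frequency sequence: finite support)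
InA : ℕ → ℤ → Seq → Set
InA k u f = FiniteSupport f × (∀ (i : ℤ) → f i ℕ.+ f (i ℤ.+ + 1) ℕ.≤ k)
                            × (∀ (i : ℤ) → i ℤ.< u → f i ≡ 0)

_≗ˢ_ : Seq → Seq → Set
f ≗ˢ g = ∀ (i : ℤ) → f i ≡ g i

module Submission where

-- Parts are processed from the back, so
-- the frame pair (a , 0) of the part m processed last sits in front of the already
-- processed sequence y, whose pair sums are at most a.  Its m particle motions carry it
-- over y: with the focus at p it makes slack a y p = a ∸ (y (p - 1) + y p) motions and
-- then moves on, so the result is y with a pair of sum a inserted where the slacks add
-- up to m.  Conversely, the result determines a as its largest pair sum, the insertion
-- place as the first place where a is attained, and m from the slacks before it;
-- deleting that pair gives back y.  The order of the parts (frame values decreasing,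
-- parts increasing within a frame value) is exactly what makes this reading correct,
-- which gives injectivity; peeling off the first maximal pair of any f ∈ 𝒜_{k,u} again
-- and again gives surjectivity.

open import Defs
open import Data.Nat as ℕ using (ℕ; zero; suc; _+_; _∸_; _≤_; _<_; z≤n; s≤s; _≤?_; _<?_)
open import Data.Nat.Properties
open import Data.Integer as ℤ using (ℤ; +_; -[1+_])
import Data.Integer.Properties as ℤ
open import Data.Integer.Tactic.RingSolver using (solve-∀)
open import Data.Product using (∃; ∃₂; _×_; _,_; proj₁; proj₂)
open import Data.Product.Properties using (,-injectiveʳ)
open import Data.Sum using (_⊎_; inj₁; inj₂)
open import Data.Empty using (⊥-elim)
open import Data.Unit using (⊤; tt)
open import Data.List using (List; []; _∷_; _++_; map; reverse; reverseAcc; concat; length)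
open import Data.List.Properties
  using (map-++; map-∘; map-id; map-injective; ∷-injective;
         reverse-++; length-reverse; reverse-involutive; reverse-injective)
open import Data.List.Relation.Unary.All as All using (All; []; _∷_)
import Data.List.Relation.Unary.All.Properties as All
open import Data.Vec using (Vec; []; _∷_; toList)
open import Data.Vec.Relation.Unary.All using ([]; _∷_) renaming (All to VAll)
open import Data.List.Relation.Unary.Linked using (Linked; []; [-]; _∷_)
open import Function using (_∘_; flip)
open import Relation.Nullary using (¬_; Dec; yes; no)
open import Relation.Binary.PropositionalEquality
open import Relation.Binary.Definitions using (tri<; tri≈; tri>)

-- Sequences indexed from the origin

Seq⁺ : Set
Seq⁺ = ℕ → ℕ

infixr 5 _∷ₛ_

_∷ₛ_ : ℕ → Seq⁺ → Seq⁺
(c ∷ₛ z) zero    = c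
(c ∷ₛ z) (suc i) = z i

tailₛ : Seq⁺ → Seq⁺
tailₛ z i = z (suc i)

insert₂ : ℕ → ℕ → ℕ → Seq⁺ → Seq⁺
insert₂ zero    s b z = s ∷ₛ b ∷ₛ z
insert₂ (suc p) s b z = z 0 ∷ₛ insert₂ p s b (tailₛ z)

remove₂ : ℕ → Seq⁺ → Seq⁺
remove₂ zero    z = tailₛ (tailₛ z)
remove₂ (suc p) z = z 0 ∷ₛ remove₂ p (tailₛ z)

data Position (p : ℕ) : ℕ → Set where
  before : ∀ {i} → i < p → Position p i
  focus  : Position p p
  next   : Position p (suc p)
  after  : ∀ {j} → p ≤ j → Position p (suc (suc j))

position : ∀ p i → Position p i
position zero    zero          = focus
position zero    (suc zero)    = next
position zero    (suc (suc j)) = after z≤n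
position (suc p) zero          = before (s≤s z≤n)
position (suc p) (suc i) with position p i
... | before i<p = before (s≤s i<p)
... | focus      = focus
... | next       = next
... | after p≤j  = after (s≤s p≤j)

module _ {s b : ℕ} where

  insert₂-< : ∀ {p i} z → i < p → insert₂ p s b z i ≡ z i
  insert₂-< {suc p} {zero}  z _         = refl
  insert₂-< {suc p} {suc i} z (s≤s i<p) = insert₂-< (tailₛ z) i<p

  insert₂-focus : ∀ p z → insert₂ p s b z p ≡ s
  insert₂-focus zero    z = refl
  insert₂-focus (suc p) z = insert₂-focus p (tailₛ z)

  insert₂-next : ∀ p z → insert₂ p s b z (suc p) ≡ b
  insert₂-next zero    z = refl
  insert₂-next (suc p) z = insert₂-next p (tailₛ z)

  insert₂-> : ∀ {p j} z → p ≤ j → insert₂ p s b z (suc (suc j)) ≡ z j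
  insert₂-> {zero}          z _         = refl
  insert₂-> {suc p} {suc j} z (s≤s p≤j) = insert₂-> (tailₛ z) p≤j

  remove₂-insert₂ : ∀ p z → remove₂ p (insert₂ p s b z) ≗ z
  remove₂-insert₂ zero    z i       = refl
  remove₂-insert₂ (suc p) z zero    = refl
  remove₂-insert₂ (suc p) z (suc i) = remove₂-insert₂ p (tailₛ z) i

remove₂-< : ∀ {p i} z → i < p → remove₂ p z i ≡ z i
remove₂-< {suc p} {zero}  z _         = refl
remove₂-< {suc p} {suc i} z (s≤s i<p) = remove₂-< (tailₛ z) i<p

remove₂-≥ : ∀ {p j} z → p ≤ j → remove₂ p z j ≡ z (suc (suc j))
remove₂-≥ {zero}          z _         = refl
remove₂-≥ {suc p} {suc j} z (s≤s p≤j) = remove₂-≥ (tailₛ z) p≤j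

remove₂-cong : ∀ p {x z} → x ≗ z → remove₂ p x ≗ remove₂ p z
remove₂-cong zero    x≗z i       = x≗z (suc (suc i))
remove₂-cong (suc p) x≗z zero    = x≗z 0
remove₂-cong (suc p) x≗z (suc i) = remove₂-cong p (x≗z ∘ suc) i

pairSum : Seq⁺ → ℕ → ℕ
pairSum z i = z i + z (suc i)

prev : Seq⁺ → Seq⁺
prev z = 0 ∷ₛ z

pairSum⁻ : Seq⁺ → ℕ → ℕ
pairSum⁻ z i = prev z i + z i

Bounded : ℕ → Seq⁺ → Set
Bounded a z = ∀ i → pairSum z i ≤ a

ZeroFrom : ℕ → Seq⁺ → Set
ZeroFrom N z = ∀ i → N ≤ i → z i ≡ 0

pairSum⁻≤ : ∀ {a z} → Bounded a z → ∀ i → pairSum⁻ z i ≤ a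
pairSum⁻≤ {z = z} B zero    = ≤-trans (m≤m+n (z 0) (z 1)) (B 0)
pairSum⁻≤         B (suc i) = B i

prev-insert₂ : ∀ p {s b} z → prev (insert₂ p s b z) p ≡ prev z p
prev-insert₂ zero    z = refl
prev-insert₂ (suc p) z = insert₂-< z (n<1+n p)

insert₂-zeroFrom : ∀ p {s b N z} → ZeroFrom N z → ZeroFrom (suc (suc p) + N) (insert₂ p s b z)
insert₂-zeroFrom p {N = N} zero-z i 2+p+N≤i
  with position p i | ≤-trans (m≤m+n (suc (suc p)) N) 2+p+N≤i
... | before i<p | 2+p≤i = ⊥-elim (<-asym i<p (≤-trans (n≤1+n (suc p)) 2+p≤i))
... | focus      | 2+p≤p = ⊥-elim (<-irrefl refl (≤-trans (n≤1+n (suc p)) 2+p≤p))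
... | next       | 2+p≤i = ⊥-elim (<-irrefl refl 2+p≤i)
... | after p≤j  | _     =
  trans (insert₂-> _ p≤j) (zero-z _ (≤-trans (m≤n+m N p) (≤-pred (≤-pred 2+p+N≤i))))

remove₂-zeroFrom : ∀ {p N z} → p ≤ N → ZeroFrom (suc N) z → ZeroFrom N (remove₂ p z)
remove₂-zeroFrom {z = z} p≤N zero-z i N≤i =
  trans (remove₂-≥ z (≤-trans p≤N N≤i)) (zero-z _ (s≤s (m≤n⇒m≤1+n N≤i)))

prev-remove₂ : ∀ p z → prev (remove₂ p z) p ≡ prev z p
prev-remove₂ zero    z = refl
prev-remove₂ (suc p) z = remove₂-< z (n<1+n p)

-- One frame pair carried over a processed sequence

slack : ℕ → Seq⁺ → ℕ → ℕ
slack a z p = a ∸ pairSum⁻ z p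

motionsTo : ℕ → Seq⁺ → ℕ → ℕ
motionsTo a z zero    = 0
motionsTo a z (suc p) = motionsTo a z p + slack a z p

motionsTo-mono : ∀ {a z p q} → p ≤ q → motionsTo a z p ≤ motionsTo a z q
motionsTo-mono {q = zero}  z≤n  = ≤-refl
motionsTo-mono {q = suc q} p≤1+q with m≤n⇒m<n∨m≡n p≤1+q
... | inj₁ p<1+q = ≤-trans (motionsTo-mono (≤-pred p<1+q)) (m≤m+n _ _)
... | inj₂ refl  = ≤-refl

motionsTo-local : ∀ {a x z} p → (∀ i → i < p → x i ≡ z i) → motionsTo a x p ≡ motionsTo a z p
motionsTo-local         zero    _   = refl
motionsTo-local {a} {x} {z} (suc p) x≡z =
  cong₂ _+_ (motionsTo-local p (λ i i<p → x≡z i (m<n⇒m<1+n i<p)))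
            (cong (a ∸_) (cong₂ _+_ (prev-local p ≤-refl) (x≡z p (n<1+n p))))
  where
  prev-local : ∀ q → q ≤ p → prev x q ≡ prev z q
  prev-local zero    _     = refl
  prev-local (suc q) 1+q≤p = x≡z q (m<n⇒m<1+n 1+q≤p)

m∸[n+o]+n≡m∸o : ∀ {m} n o → n + o ≤ m → m ∸ (n + o) + n ≡ m ∸ o
m∸[n+o]+n≡m∸o {m} n o n+o≤m = begin
  m ∸ (n + o) + n  ≡⟨ cong (λ k → m ∸ k + n) (+-comm n o) ⟩
  m ∸ (o + n) + n  ≡⟨ cong (_+ n) (∸-+-assoc m o n) ⟨
  m ∸ o ∸ n + n    ≡⟨ m∸n+n≡m (m+n≤o⇒m≤o∸n n {o} {m} n+o≤m) ⟩
  m ∸ o            ∎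
  where open ≡-Reasoning

n+[m∸[o+n]]≡m∸o : ∀ {m} n o → o + n ≤ m → n + (m ∸ (o + n)) ≡ m ∸ o
n+[m∸[o+n]]≡m∸o {m} n o o+n≤m = begin
  n + (m ∸ (o + n))  ≡⟨ +-comm n _ ⟩
  m ∸ (o + n) + n    ≡⟨ cong (λ k → m ∸ k + n) (+-comm o n) ⟩
  m ∸ (n + o) + n    ≡⟨ m∸[n+o]+n≡m∸o n o (subst (_≤ m) (+-comm o n) o+n≤m) ⟩
  m ∸ o              ∎
  where open ≡-Reasoning

-- The frame pair (a , 0) put in front of y, after the focus has reached p and r
-- particle motions have been made there: it then occupies (p , p + 1) with values
-- (a ∸ b , b), where b = r + y (p - 1).  A further motion at p is possible iff the next
-- pair sum r + pairSum⁻ y p is below a; hence slack a y p motions are made at p and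
-- motionsTo a y p before the focus reaches p.
state : ℕ → Seq⁺ → ℕ → ℕ → Seq⁺
state a y p r = insert₂ p (a ∸ (r + prev y p)) (r + prev y p) y

module _ {a : ℕ} {y : Seq⁺} where

  pairSum-state-next : ∀ p r → pairSum (state a y p r) (suc p) ≡ r + pairSum⁻ y p
  pairSum-state-next p r =
    trans (cong₂ _+_ (insert₂-next p y) (insert₂-> y ≤-refl)) (+-assoc r (prev y p) (y p))

  module _ (By : Bounded a y) where

    carried≤a : ∀ p {r} → r ≤ slack a y p → r + prev y p ≤ a
    carried≤a p {r} r≤ =
      ≤-trans (+-monoʳ-≤ r (m≤m+n _ _)) (m≤o∸n⇒m+n≤o r (pairSum⁻≤ By p) r≤)

    pairSum-state-focus : ∀ p {r} → r ≤ slack a y p → pairSum (state a y p r) p ≡ a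
    pairSum-state-focus p r≤ =
      trans (cong₂ _+_ (insert₂-focus p y) (insert₂-next p y)) (m∸n+n≡m (carried≤a p r≤))

    pairSum-state-≥ : ∀ p {r} → r ≤ slack a y p → ∀ j → p ≤ j → pairSum (state a y p r) j ≤ a
    pairSum-state-≥ p {r} r≤ j p≤j with position p j
    ... | before j<p = ⊥-elim (<⇒≱ j<p p≤j)
    ... | focus      = ≤-reflexive (pairSum-state-focus p r≤)
    ... | next       = subst (_≤ a) (sym (pairSum-state-next p r))
                             (m≤o∸n⇒m+n≤o r (pairSum⁻≤ By p) r≤)
    ... | after {j′} p≤j′ =
      subst (_≤ a) (sym (cong₂ _+_ (insert₂-> y p≤j′) (insert₂-> y (m≤n⇒m≤1+n p≤j′)))) (By j′)

    state-shift : ∀ p → state a y p (slack a y p) ≗ state a y (suc p) 0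
    state-shift p i with position p i
    ... | before i<p = trans (insert₂-< y i<p) (sym (insert₂-< y (m<n⇒m<1+n i<p)))
    ... | focus      = begin
      state a y p (slack a y p) p   ≡⟨ insert₂-focus p y ⟩
      a ∸ (slack a y p + prev y p)  ≡⟨ cong (a ∸_) (m∸[n+o]+n≡m∸o (prev y p) (y p) (pairSum⁻≤ By p)) ⟩
      a ∸ (a ∸ y p)                 ≡⟨ m∸[m∸n]≡n (≤-trans (m≤n+m (y p) _) (pairSum⁻≤ {z = y} By p)) ⟩
      y p                           ≡⟨ insert₂-< y (n<1+n p) ⟨
      state a y (suc p) 0 p         ∎
      where open ≡-Reasoning
    ... | next       = trans (insert₂-next p y)
                             (trans (m∸[n+o]+n≡m∸o (prev y p) (y p) (pairSum⁻≤ By p))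
                                    (sym (insert₂-focus (suc p) y)))
    ... | after {j} p≤j with m≤n⇒m<n∨m≡n p≤j
    ...   | inj₁ p<j  = trans (insert₂-> y p≤j) (sym (insert₂-> y p<j))
    ...   | inj₂ refl = trans (insert₂-> y p≤j) (sym (insert₂-next (suc p) y))

-- Run a y (n , t) m (p , r): the particle motions of the pair a over y, started with the
-- focus at n after t motions there, make m motions and stop with the focus at p after
-- r motions there.
data Run (a : ℕ) (y : Seq⁺) : ℕ × ℕ → ℕ → ℕ × ℕ → Set where
  halt  : ∀ {s} → Run a y s 0 s
  move  : ∀ {n t m s} → t < slack a y n → Run a y (n , suc t) m s → Run a y (n , t) (suc m) s
  shift : ∀ {n t m s} → t ≡ slack a y n → Run a y (suc n , 0) (suc m) s → Run a y (n , t) (suc m) s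

-- (p , slack a y p) and (suc p , 0) describe the same state; a run stops right after a
-- motion, so it ends with r ≥ 1 unless it makes no motion at all.
Canonical : ℕ → ℕ → Set
Canonical p r = 1 ≤ r ⊎ (p ≡ 0 × r ≡ 0)

Canonical⇒1≤r : ∀ {p r} → 1 ≤ p → Canonical p r → 1 ≤ r
Canonical⇒1≤r _       (inj₁ 1≤r)     = 1≤r
Canonical⇒1≤r (s≤s _) (inj₂ (() , _))

module _ {a : ℕ} {y : Seq⁺} {p r : ℕ} (r≤slack : r ≤ slack a y p) where

  private
    D : ℕ → ℕ
    D = motionsTo a y

  -- Each motion raises the potential D n + t by one; focus shifts leave it unchanged.
  run-from : 1 ≤ r → ∀ m k {n t} → k + n ≡ p → t ≤ slack a y n →
             m + (D n + t) ≡ D p + r → Run a y (n , t) m (p , r)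
  run-from 1≤r zero zero {t = t} refl t≤ eq with +-cancelˡ-≡ (D p) t r eq
  ... | refl = halt
  run-from 1≤r zero (suc k) {n} {t} refl t≤ eq =
    ⊥-elim (<⇒≱ 1≤r (+-cancelˡ-≤ (D p) r 0 D[p]+r≤D[p]))
    where
    D[p]+r≤D[p] : D p + r ≤ D p + 0
    D[p]+r≤D[p] = begin
      D p + r          ≡⟨ eq ⟨
      D n + t          ≤⟨ +-monoʳ-≤ (D n) t≤ ⟩
      D (suc n)        ≤⟨ motionsTo-mono (s≤s (m≤n+m n k)) ⟩
      D p              ≡⟨ +-identityʳ (D p) ⟨
      D p + 0          ∎
      where open ≤-Reasoning
  run-from 1≤r (suc m) k {n} {t} k+n≡p t≤ eq with t <? slack a y n
  ... | yes t<slack = move t<slack (run-from 1≤r m k k+n≡p t<slack eq′)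
    where
    eq′ : m + (D n + suc t) ≡ D p + r
    eq′ = trans (cong (_+_ m) (+-suc (D n) t)) (trans (+-suc m _) eq)
  run-from 1≤r (suc m) zero {t = t} refl t≤ eq | no t≮slack =
    ⊥-elim (<⇒≱ (+-cancelˡ-≤ (D p) (suc t) r D[p]+1+t≤D[p]+r) (≤-trans r≤slack (≮⇒≥ t≮slack)))
    where
    D[p]+1+t≤D[p]+r : D p + suc t ≤ D p + r
    D[p]+1+t≤D[p]+r =
      ≤-trans (≤-reflexive (+-suc (D p) t)) (≤-trans (s≤s (m≤n+m _ m)) (≤-reflexive eq))
  run-from 1≤r (suc m) (suc k) {n} {t} k+n≡p t≤ eq | no t≮slack
    with ≤-antisym t≤ (≮⇒≥ t≮slack)
  ... | refl = shift refl (run-from 1≤r (suc m) k (trans (+-suc k n) k+n≡p) z≤n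
                                    (trans (cong (_+_ (suc m)) (+-identityʳ _)) eq))

  run-to : Canonical p r → Run a y (0 , 0) (D p + r) (p , r)
  run-to (inj₁ 1≤r)          = run-from 1≤r (D p + r) p (+-identityʳ p) z≤n (+-identityʳ _)
  run-to (inj₂ (refl , refl)) = halt

module _ {a : ℕ} {y : Seq⁺} (1≤a : 1 ≤ a) {N : ℕ} (zero-y : ZeroFrom N y) where

  private
    D : ℕ → ℕ
    D = motionsTo a y

    slack-beyond : ∀ j → N ≤ j → slack a y (suc j) ≡ a
    slack-beyond j N≤j = cong (a ∸_) (cong₂ _+_ (zero-y j N≤j) (zero-y (suc j) (m≤n⇒m≤1+n N≤j)))

  motionsTo-unbounded : ∀ m → m ≤ D (suc (N + m))
  motionsTo-unbounded zero    = z≤n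
  motionsTo-unbounded (suc m) = begin
    suc m                  ≡⟨ +-comm 1 m ⟩
    m + 1                  ≤⟨ +-mono-≤ (motionsTo-unbounded m) 1≤a ⟩
    D (suc (N + m)) + a    ≡⟨ cong (_+_ (D (suc (N + m)))) (slack-beyond (N + m) (m≤m+n N m)) ⟨
    D (suc (suc (N + m)))  ≡⟨ cong (D ∘ suc) (+-suc N m) ⟨
    D (suc (N + suc m))    ∎
    where open ≤-Reasoning

  private
    first-reaching : ∀ m q → m ≤ D q → 1 ≤ m → ∃ λ p → D p < m × m ≤ D (suc p)
    first-reaching m zero    m≤0       1≤m = ⊥-elim (<⇒≱ 1≤m m≤0)
    first-reaching m (suc q) m≤D[1+q] 1≤m with m ≤? D q
    ... | yes m≤D[q] = first-reaching m q m≤D[q] 1≤m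
    ... | no  m≰D[q] = q , ≰⇒> m≰D[q] , m≤D[1+q]

  split-motions : ∀ m → ∃₂ λ p r → r ≤ slack a y p × Canonical p r × D p + r ≡ m
  split-motions zero    = 0 , 0 , z≤n , inj₂ (refl , refl) , refl
  split-motions (suc m)
    with first-reaching (suc m) (suc (N + suc m)) (motionsTo-unbounded (suc m)) (s≤s z≤n)
  ... | p , D[p]<1+m , 1+m≤D[1+p] =
    p , suc m ∸ D p ,
    subst (suc m ∸ D p ≤_) (m+n∸m≡n (D p) (slack a y p)) (∸-monoˡ-≤ (D p) 1+m≤D[1+p]) ,
    inj₁ (m<n⇒0<n∸m D[p]<1+m) , m+[n∸m]≡n (<⇒≤ D[p]<1+m)

-- Particle motions on ℤ-indexed sequences

restrict : ℤ → Seq → Seq⁺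
restrict u f n = f (u ℤ.+ + n)

u+[i-u]≡i : ∀ u i → u ℤ.+ (i ℤ.- u) ≡ i
u+[i-u]≡i = solve-∀

[u+i]-u≡i : ∀ u i → (u ℤ.+ i) ℤ.- u ≡ i
[u+i]-u≡i = solve-∀

[u+n]+k≡u+[k+n] : ∀ u n k → u ℤ.+ + n ℤ.+ + k ≡ u ℤ.+ + (k + n)
[u+n]+k≡u+[k+n] u n k = trans (ℤ.+-assoc u (+ n) (+ k)) (cong (λ j → u ℤ.+ + j) (+-comm n k))

+-offset-injective : ∀ u {m n} → u ℤ.+ + m ≡ u ℤ.+ + n → m ≡ n
+-offset-injective u {m} {n} eq =
  ℤ.+-injective (trans (sym ([u+i]-u≡i u (+ m))) (trans (cong (ℤ._- u) eq) ([u+i]-u≡i u (+ n))))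

data Offset (u : ℤ) : ℤ → Set where
  from  : ∀ n → Offset u (u ℤ.+ + n)
  below : ∀ {i} → i ℤ.< u → Offset u i

offset : ∀ u i → Offset u i
offset u i with i ℤ.- u | u+[i-u]≡i u i
... | + n      | eq = subst (Offset u) eq (from n)
... | -[1+ n ] | eq = below (subst₂ ℤ._<_ eq (ℤ.+-identityʳ u) (ℤ.+-monoʳ-< u ℤ.-<+))

below⇒≢offset : ∀ {u i} n → i ℤ.< u → i ≢ u ℤ.+ + n
below⇒≢offset {u} n i<u refl = ℤ.<⇒≱ i<u (ℤ.i≤i+j u (+ n))

u<u+[1+n] : ∀ u n → u ℤ.< u ℤ.+ + suc n
u<u+[1+n] u n = subst (ℤ._< u ℤ.+ + suc n) (ℤ.+-identityʳ u) (ℤ.+-monoʳ-< u (ℤ.+<+ (s≤s z≤n)))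

≗-from-restrict : ∀ {u f g} → restrict u f ≗ restrict u g → (∀ i → i ℤ.< u → f i ≡ g i) → f ≗ˢ g
≗-from-restrict {u} f≗g below-eq i with offset u i
... | from n    = f≗g n
... | below i<u = below-eq i i<u

module _ (w : ℤ) (f : Seq) where

  private
    w≢w+1 : w ≢ w ℤ.+ + 1
    w≢w+1 = ℤ.<⇒≢ (u<u+[1+n] w 0)

  moveAt-focus : moveAt w f w ≡ f w ∸ 1
  moveAt-focus with w ℤ.≟ w | w ℤ.≟ (w ℤ.+ + 1)
  ... | yes _  | _ = refl
  ... | no w≢w | _ = ⊥-elim (w≢w refl)

  moveAt-next : moveAt w f (w ℤ.+ + 1) ≡ suc (f (w ℤ.+ + 1))
  moveAt-next with (w ℤ.+ + 1) ℤ.≟ w | (w ℤ.+ + 1) ℤ.≟ (w ℤ.+ + 1)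
  ... | yes w+1≡w | _    = ⊥-elim (w≢w+1 (sym w+1≡w))
  ... | no _      | yes _ = refl
  ... | no _      | no ≢w+1 = ⊥-elim (≢w+1 refl)

  moveAt-other : ∀ {i} → i ≢ w → i ≢ w ℤ.+ + 1 → moveAt w f i ≡ f i
  moveAt-other {i} i≢w i≢w+1 with i ℤ.≟ w | i ℤ.≟ (w ℤ.+ + 1)
  ... | yes i≡w | _         = ⊥-elim (i≢w i≡w)
  ... | no _    | yes i≡w+1 = ⊥-elim (i≢w+1 i≡w+1)
  ... | no _    | no _      = refl

PM-below : ∀ {w m f g} → PM w m f g → ∀ i → i ℤ.< w → g i ≡ f i
PM-below pm-done              i i<w = refl
PM-below {w} {f = f} (pm-move _ _ P) i i<w =
  trans (PM-below P i i<w) (moveAt-other w f (ℤ.<⇒≢ i<w) (ℤ.<⇒≢ (ℤ.<-trans i<w (u<u+[1+n] w 0))))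
PM-below {w} (pm-shift _ _ P) i i<w = PM-below P i (ℤ.<-trans i<w (u<u+[1+n] w 0))

PM-deterministic : ∀ {w m f g h} → PM w m f g → PM w m f h → g ≡ h
PM-deterministic pm-done          pm-done          = refl
PM-deterministic (pm-move _ _ P)  (pm-move _ _ Q)  = PM-deterministic P Q
PM-deterministic (pm-move _ lt _) (pm-shift _ eq _) = ⊥-elim (<-irrefl eq lt)
PM-deterministic (pm-shift _ eq _) (pm-move _ lt _) = ⊥-elim (<-irrefl eq lt)
PM-deterministic (pm-shift _ _ P) (pm-shift _ _ Q) = PM-deterministic P Q

ApplyAll-deterministic : ∀ {w L f g h} → ApplyAll w L f g → ApplyAll w L f h → g ≡ h
ApplyAll-deterministic aa-nil         aa-nil         = refl
ApplyAll-deterministic (aa-cons A P) (aa-cons B Q) with ApplyAll-deterministic A B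
... | refl = PM-deterministic P Q

module Simulation {a : ℕ} {y : Seq⁺} (By : Bounded a y) (u : ℤ) where

  module _ {n t : ℕ} {f : Seq} (f≗ : restrict u f ≗ state a y n t) where

    private
      w : ℤ
      w = u ℤ.+ + n

      f[w+k] : ∀ k → f (w ℤ.+ + k) ≡ state a y n t (k + n)
      f[w+k] k = trans (cong f ([u+n]+k≡u+[k+n] u n k)) (f≗ (k + n))

    pairSum-focus : t ≤ slack a y n → f w + f (w ℤ.+ + 1) ≡ a
    pairSum-focus t≤ = trans (cong₂ _+_ (f≗ n) (f[w+k] 1)) (pairSum-state-focus By n t≤)

    pairSum-next : f (w ℤ.+ + 1) + f (w ℤ.+ + 2) ≡ t + pairSum⁻ y n
    pairSum-next = trans (cong₂ _+_ (f[w+k] 1) (f[w+k] 2)) (pairSum-state-next n t)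

    admissible : t ≤ slack a y n → Admissible w f
    admissible t≤ v w≤v with offset w v
    ... | below v<w = ⊥-elim (ℤ.<⇒≱ v<w w≤v)
    ... | from j    = subst₂ _≤_ (sym (cong₂ _+_ f[w+j] f[w+j+1])) (sym (pairSum-focus t≤))
                             (pairSum-state-≥ By n t≤ (n + j) (m≤m+n n j))
      where
      f[w+j] : f (w ℤ.+ + j) ≡ state a y n t (n + j)
      f[w+j] = trans (cong f (ℤ.+-assoc u (+ n) (+ j))) (f≗ (n + j))
      f[w+j+1] : f (w ℤ.+ + j ℤ.+ + 1) ≡ state a y n t (suc (n + j))
      f[w+j+1] = trans (cong (λ i → f (i ℤ.+ + 1)) (ℤ.+-assoc u (+ n) (+ j)))
                       (trans (cong f ([u+n]+k≡u+[k+n] u (n + j) 1)) (f≗ (suc (n + j))))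

    motion-possible : t < slack a y n → f (w ℤ.+ + 1) + f (w ℤ.+ + 2) ℕ.< f w + f (w ℤ.+ + 1)
    motion-possible t<slack = subst₂ ℕ._<_ (sym pairSum-next) (sym (pairSum-focus (<⇒≤ t<slack)))
                                     (m≤o∸n⇒m+n≤o (suc t) (pairSum⁻≤ By n) t<slack)

    shift-forced : t ≡ slack a y n → f (w ℤ.+ + 1) + f (w ℤ.+ + 2) ≡ f w + f (w ℤ.+ + 1)
    shift-forced refl = trans pairSum-next (trans (m∸n+n≡m (pairSum⁻≤ By n))
                                                  (sym (pairSum-focus ≤-refl)))

    private
      moveAt-away : ∀ {i} → i ≢ n → i ≢ suc n → moveAt w f (u ℤ.+ + i) ≡ f (u ℤ.+ + i)
      moveAt-away i≢n i≢1+n =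
        moveAt-other w f (i≢n ∘ +-offset-injective u)
                         (λ eq → i≢1+n (+-offset-injective u (trans eq ([u+n]+k≡u+[k+n] u n 1))))

    restrict-moveAt : restrict u (moveAt w f) ≗ state a y n (suc t)
    restrict-moveAt i with position n i
    ... | before i<n = trans (moveAt-away (<⇒≢ i<n) (<⇒≢ (m<n⇒m<1+n i<n)))
                             (trans (f≗ i) (trans (insert₂-< y i<n) (sym (insert₂-< y i<n))))
    ... | focus = begin
      moveAt w f w                         ≡⟨ moveAt-focus w f ⟩
      f w ∸ 1                              ≡⟨ cong (_∸ 1) (trans (f≗ n) (insert₂-focus n y)) ⟩
      a ∸ (t + prev y n) ∸ 1               ≡⟨ ∸-+-assoc a (t + prev y n) 1 ⟩
      a ∸ (t + prev y n + 1)               ≡⟨ cong (a ∸_) (+-comm _ 1) ⟩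
      a ∸ (suc t + prev y n)               ≡⟨ insert₂-focus n y ⟨
      state a y n (suc t) n                ∎
      where open ≡-Reasoning
    ... | next = begin
      moveAt w f (u ℤ.+ + suc n)           ≡⟨ cong (moveAt w f) ([u+n]+k≡u+[k+n] u n 1) ⟨
      moveAt w f (w ℤ.+ + 1)               ≡⟨ moveAt-next w f ⟩
      suc (f (w ℤ.+ + 1))                  ≡⟨ cong suc (trans (f[w+k] 1) (insert₂-next n y)) ⟩
      suc t + prev y n                     ≡⟨ insert₂-next n y ⟨
      state a y n (suc t) (suc n)          ∎
      where open ≡-Reasoning
    ... | after n≤j = trans (moveAt-away (>⇒≢ (s≤s (m≤n⇒m≤1+n n≤j))) (>⇒≢ (s≤s (s≤s n≤j))))
                            (trans (f≗ _) (trans (insert₂-> y n≤j) (sym (insert₂-> y n≤j))))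

  simulate : ∀ {n t m p r f} → Run a y (n , t) m (p , r) → t ≤ slack a y n →
             restrict u f ≗ state a y n t →
             ∃ λ h → PM (u ℤ.+ + n) m f h × restrict u h ≗ state a y p r
  simulate halt _ f≗ = _ , pm-done , f≗
  simulate {n} {t} {f = f} (move t<slack run) t≤ f≗
    with simulate run t<slack (restrict-moveAt {n} {t} {f} f≗)
  ... | h , P , h≗ =
    h , pm-move (admissible {n} {t} {f} f≗ t≤) (motion-possible {n} {t} {f} f≗ t<slack) P , h≗
  simulate {n} {t} {f = f} (shift refl run) t≤ f≗
    with simulate run z≤n (λ i → trans (f≗ i) (state-shift By n i))
  ... | h , P , h≗ =
    h , pm-shift (admissible {n} {t} {f} f≗ t≤) (shift-forced {n} {t} {f} f≗ refl)
                 (subst (λ v → PM v _ f h) (sym ([u+n]+k≡u+[k+n] u n 1)) P) , h≗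

-- Lists of entries and the sequences they build

Entry : Set
Entry = ℕ × ℕ

Precedes : Entry → List Entry → Set
Precedes _       []               = ⊤
Precedes (a , m) ((a′ , m′) ∷ _) = a′ < a ⊎ (a′ ≡ a × m ≤ m′)

-- An entry (a , m) stands for a part m whose frame pair is (a , 0).  The parts
-- λ_0, λ_1, … of a K-tuple form a valid list: frame values weakly decrease from K to 1,
-- and parts weakly increase within a block.
data Valid (K : ℕ) : List Entry → Set where
  []   : Valid K []
  cons : ∀ {a m L} → 1 ≤ a → a ≤ K → Valid a L → Precedes (a , m) L → Valid K ((a , m) ∷ L)

-- Builds L x: the motions of L, applied to the frame sequence of L, produce x (read from
-- the origin on).  The head of L is the entry processed last.
data Builds : List Entry → Seq⁺ → Set where
  empty  : ∀ {x} → (∀ i → x i ≡ 0) → Builds [] x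
  insert : ∀ {a m L y x} p r → Builds L y → r ≤ slack a y p → Canonical p r →
           motionsTo a y p + r ≡ m → x ≗ state a y p r → Builds ((a , m) ∷ L) x

-- The entry (a , m) processed last is visible in the result x: a is the largest pair sum
-- of x, pos the first place where it is attained, and m = motionsTo a x (suc pos).
record Peak (a m : ℕ) (x : Seq⁺) : Set where
  field
    bounded  : Bounded a x
    pos      : ℕ
    <-before : ∀ i → i < pos → pairSum x i < a
    ≡-at     : pairSum x pos ≡ a
    motions  : motionsTo a x (suc pos) ≡ m

prev-≗ : ∀ {x z} → x ≗ z → prev x ≗ prev z
prev-≗ x≗z zero    = refl
prev-≗ x≗z (suc i) = x≗z i

state-peak : ∀ {a m y p r x} → 1 ≤ a → Bounded a y → (∀ i → suc i < p → pairSum y i < a) →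
             r ≤ slack a y p → Canonical p r → motionsTo a y p + r ≡ m → x ≗ state a y p r →
             Peak a m x
state-peak {a} {m} {y} {p} {r} {x} 1≤a By below-p r≤ canon eq x≗ = record
  { bounded = bounded ; pos = p ; <-before = <a-before ; ≡-at = ≡a-at ; motions = trans motions eq }
  where
  pairSum-x : ∀ i → pairSum x i ≡ pairSum (state a y p r) i
  pairSum-x i = cong₂ _+_ (x≗ i) (x≗ (suc i))

  r+prev≤a : r + prev y p ≤ a
  r+prev≤a = carried≤a By p r≤

  <a-before : ∀ i → i < p → pairSum x i < a
  <a-before i i<p with m≤n⇒m<n∨m≡n i<p
  ... | inj₁ 1+i<p =
    subst (_< a) (sym (trans (pairSum-x i) (cong₂ _+_ (insert₂-< y i<p) (insert₂-< y 1+i<p))))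
          (below-p i 1+i<p)
  ... | inj₂ refl = begin-strict
    pairSum x i            ≡⟨ trans (pairSum-x i) (cong₂ _+_ (insert₂-< y i<p) (insert₂-focus p y)) ⟩
    y i + (a ∸ (r + y i))  ≡⟨ n+[m∸[o+n]]≡m∸o (y i) r r+prev≤a ⟩
    a ∸ r                  <⟨ ∸-monoʳ-< (Canonical⇒1≤r (s≤s z≤n) canon) (m+n≤o⇒m≤o r r+prev≤a) ⟩
    a                      ∎
    where open ≤-Reasoning

  ≡a-at : pairSum x p ≡ a
  ≡a-at = trans (pairSum-x p) (pairSum-state-focus By p r≤)

  bounded : Bounded a x
  bounded i with i <? p
  ... | yes i<p = <⇒≤ (<a-before i i<p)
  ... | no  i≮p = subst (_≤ a) (sym (pairSum-x i)) (pairSum-state-≥ By p r≤ i (≮⇒≥ i≮p))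

  slack-x : slack a x p ≡ r
  slack-x = begin
    a ∸ (prev x p + x p)
      ≡⟨ cong (a ∸_) (cong₂ _+_ (trans (prev-≗ x≗ p) (prev-insert₂ p y))
                                (trans (x≗ p) (insert₂-focus p y))) ⟩
    a ∸ (prev y p + (a ∸ (r + prev y p)))
      ≡⟨ cong (a ∸_) (n+[m∸[o+n]]≡m∸o (prev y p) r r+prev≤a) ⟩
    a ∸ (a ∸ r)
      ≡⟨ m∸[m∸n]≡n (m+n≤o⇒m≤o r r+prev≤a) ⟩
    r ∎
    where open ≡-Reasoning

  motions : motionsTo a x (suc p) ≡ motionsTo a y p + r
  motions = cong₂ _+_ (motionsTo-local p (λ i i<p → trans (x≗ i) (insert₂-< y i<p))) slack-x

builds-zeroFrom : ∀ {L x} → Builds L x → ∃ λ N → ZeroFrom N x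
builds-zeroFrom (empty x≡0) = 0 , λ i _ → x≡0 i
builds-zeroFrom (insert p r B _ _ _ x≗) with builds-zeroFrom B
... | N , zero-y = suc (suc p) + N , λ i N′≤i → trans (x≗ i) (insert₂-zeroFrom p zero-y i N′≤i)

builds-peak : ∀ {K a m L x} → Valid K ((a , m) ∷ L) → Builds ((a , m) ∷ L) x → Peak a m x
builds-bounded : ∀ {K L x} → Valid K L → Builds L x → Bounded K x
tail-pairSum< : ∀ {a m L y p r} → 1 ≤ a → Valid a L → Precedes (a , m) L → Builds L y →
                Canonical p r → motionsTo a y p + r ≡ m → ∀ i → suc i < p → pairSum y i < a

builds-peak (cons 1≤a _ V prec) (insert p r B r≤ canon eq x≗) =
  state-peak 1≤a (builds-bounded V B) (tail-pairSum< 1≤a V prec B canon eq) r≤ canon eq x≗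

builds-bounded {K} []                   (empty x≡0) i =
  subst (_≤ K) (sym (cong₂ _+_ (x≡0 i) (x≡0 (suc i)))) z≤n
builds-bounded V@(cons _ a≤K _ _) B@(insert _ _ _ _ _ _ _) i =
  ≤-trans (Peak.bounded (builds-peak V B) i) a≤K

tail-pairSum< {a} 1≤a [] _ (empty y≡0) _ _ i _ =
  subst (_< a) (sym (cong₂ _+_ (y≡0 i) (y≡0 (suc i)))) 1≤a
tail-pairSum< 1≤a V@(cons _ _ _ _) (inj₁ a′<a) B _ _ i _ =
  ≤-<-trans (Peak.bounded (builds-peak V B) i) a′<a
tail-pairSum< {a} {y = y} {p} {r} 1≤a V@(cons {m = m′} _ _ _ _) (inj₂ (refl , m≤m′)) B canon refl
              i 1+i<p
  with i <? Peak.pos (builds-peak V B)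
... | yes i<pos = Peak.<-before (builds-peak V B) i i<pos
... | no  i≮pos = ⊥-elim (<⇒≱ m′<m m≤m′)
  -- y attains a before p - 1 only if its own last entry made fewer motions than m
  where
  pk = builds-peak V B
  1+pos≤p : suc (Peak.pos pk) ≤ p
  1+pos≤p = ≤-trans (s≤s (≮⇒≥ i≮pos)) (<⇒≤ 1+i<p)
  m′<m : m′ < motionsTo a y p + r
  m′<m = begin-strict
    m′                                ≡⟨ Peak.motions pk ⟨
    motionsTo a y (suc (Peak.pos pk)) ≤⟨ motionsTo-mono 1+pos≤p ⟩
    motionsTo a y p                   <⟨ m<m+n _ (Canonical⇒1≤r (≤-trans (s≤s z≤n) 1+pos≤p) canon) ⟩
    motionsTo a y p + r               ∎
    where open ≤-Reasoning

peak-unique : ∀ {a m x a′ m′ x′} → x ≗ x′ → (pk : Peak a m x) (pk′ : Peak a′ m′ x′) →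
              a ≡ a′ × Peak.pos pk ≡ Peak.pos pk′ × m ≡ m′
peak-unique {a} {m} {x} {a′} {m′} {x′} x≗x′ pk pk′ = a≡a′ , pos≡pos′ , m≡m′
  where
  open Peak pk
  module P′ = Peak pk′

  pairSum-≗ : ∀ i → pairSum x i ≡ pairSum x′ i
  pairSum-≗ i = cong₂ _+_ (x≗x′ i) (x≗x′ (suc i))

  a≡a′ : a ≡ a′
  a≡a′ = ≤-antisym (subst (_≤ a′) (trans (sym (pairSum-≗ pos)) ≡-at) (P′.bounded pos))
                   (subst (_≤ a) (trans (pairSum-≗ P′.pos) P′.≡-at) (bounded P′.pos))

  pos≡pos′ : pos ≡ P′.pos
  pos≡pos′ with <-cmp pos P′.pos
  ... | tri< pos<pos′ _ _ =
    ⊥-elim (<-irrefl (trans (trans (sym (pairSum-≗ pos)) ≡-at) a≡a′) (P′.<-before pos pos<pos′))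
  ... | tri≈ _ pos≡pos′ _ = pos≡pos′
  ... | tri> _ _ pos′<pos =
    ⊥-elim (<-irrefl (trans (trans (pairSum-≗ P′.pos) P′.≡-at) (sym a≡a′)) (<-before P′.pos pos′<pos))

  m≡m′ : m ≡ m′
  m≡m′ = begin
    m                            ≡⟨ motions ⟨
    motionsTo a x (suc pos)      ≡⟨ motionsTo-local (suc pos) (λ i _ → x≗x′ i) ⟩
    motionsTo a x′ (suc pos)     ≡⟨ cong₂ (λ b q → motionsTo b x′ (suc q)) a≡a′ pos≡pos′ ⟩
    motionsTo a′ x′ (suc P′.pos) ≡⟨ P′.motions ⟩
    m′                           ∎
    where open ≡-Reasoning

remove₂-state : ∀ a y p r {x} → x ≗ state a y p r → remove₂ p x ≗ y
remove₂-state a y p r x≗ i = trans (remove₂-cong p x≗ i) (remove₂-insert₂ p y i)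

peak-nonzero : ∀ {a m x} → 1 ≤ a → Peak a m x → ¬ (∀ i → x i ≡ 0)
peak-nonzero 1≤a pk x≡0 =
  <⇒≱ 1≤a (≤-reflexive (trans (sym (Peak.≡-at pk)) (cong₂ _+_ (x≡0 _) (x≡0 _))))

builds-injective : ∀ {K K′ L L′ x x′} → Valid K L → Valid K′ L′ → Builds L x → Builds L′ x′ →
                   x ≗ x′ → L ≡ L′
builds-injective [] [] _ _ _ = refl
builds-injective [] V′@(cons 1≤a _ _ _) (empty x≡0) B′ x≗x′ =
  ⊥-elim (peak-nonzero 1≤a (builds-peak V′ B′) (λ i → trans (sym (x≗x′ i)) (x≡0 i)))
builds-injective V@(cons 1≤a _ _ _) [] B (empty x′≡0) x≗x′ =
  ⊥-elim (peak-nonzero 1≤a (builds-peak V B) (λ i → trans (x≗x′ i) (x′≡0 i)))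
builds-injective {x = x} {x′} V@(cons _ _ VL _) V′@(cons _ _ VL′ _)
                 B@(insert {a} {y = y} p r BL _ _ _ x≗) B′@(insert {a′} {y = y′} p′ r′ BL′ _ _ _ x′≗)
                 x≗x′
  with peak-unique x≗x′ (builds-peak V B) (builds-peak V′ B′)
... | a≡a′ , p≡p′ , m≡m′ = cong₂ _∷_ (cong₂ _,_ a≡a′ m≡m′) (builds-injective VL VL′ BL BL′ y≗y′)
  where
  y≗y′ : y ≗ y′
  y≗y′ i = begin
    y i               ≡⟨ remove₂-state a y p r x≗ i ⟨
    remove₂ p x i     ≡⟨ remove₂-cong p x≗x′ i ⟩
    remove₂ p x′ i    ≡⟨ cong (λ q → remove₂ q x′ i) p≡p′ ⟩
    remove₂ p′ x′ i   ≡⟨ remove₂-state a′ y′ p′ r′ x′≗ i ⟩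
    y′ i              ∎
    where open ≡-Reasoning

builds-exists : ∀ {K L} → Valid K L → ∃ λ x → Builds L x
builds-exists [] = (λ _ → 0) , empty (λ _ → refl)
builds-exists {L = (a , m) ∷ _} (cons 1≤a _ V _) with builds-exists V
... | y , B with builds-zeroFrom B
... | N , zero-y with split-motions 1≤a zero-y m
... | p , r , r≤ , canon , eq = state a y p r , insert p r B r≤ canon eq (λ _ → refl)

-- Peeling off the peak

leftmostMax : (z : ℕ → ℕ) → ∀ N →
              ∃ λ P → P ≤ N × (∀ i → i < P → z i < z P) × (∀ i → i ≤ N → z i ≤ z P)
leftmostMax z zero = 0 , z≤n , (λ _ ()) , λ { .0 z≤n → ≤-refl }
leftmostMax z (suc N) with leftmostMax z N
... | P , P≤N , <P , ≤P with z P <? z (suc N)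
... | yes z[P]<z[1+N] =
  suc N , ≤-refl , (λ i i<1+N → ≤-<-trans (≤P i (≤-pred i<1+N)) z[P]<z[1+N]) , ≤1+N
  where
  ≤1+N : ∀ i → i ≤ suc N → z i ≤ z (suc N)
  ≤1+N i i≤1+N with m≤n⇒m<n∨m≡n i≤1+N
  ... | inj₁ i<1+N = ≤-trans (≤P i (≤-pred i<1+N)) (<⇒≤ z[P]<z[1+N])
  ... | inj₂ refl  = ≤-refl
... | no z[P]≮z[1+N] = P , m≤n⇒m≤1+n P≤N , <P , ≤P′
  where
  ≤P′ : ∀ i → i ≤ suc N → z i ≤ z P
  ≤P′ i i≤1+N with m≤n⇒m<n∨m≡n i≤1+N
  ... | inj₁ i<1+N = ≤P i (≤-pred i<1+N)
  ... | inj₂ refl  = ≮⇒≥ z[P]≮z[1+N]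

module Peel {a m : ℕ} {x : Seq⁺} (pk : Peak a m x) where

  open Peak pk

  y : Seq⁺
  y = remove₂ pos x

  r : ℕ
  r = slack a x pos

  private
    x[pos]≤a : x pos ≤ a
    x[pos]≤a = ≤-trans (m≤m+n _ _) (≤-reflexive ≡-at)

    x[2+pos]≤x[pos] : x (suc (suc pos)) ≤ x pos
    x[2+pos]≤x[pos] = +-cancelˡ-≤ (x (suc pos)) _ _
      (≤-trans (bounded (suc pos)) (≤-reflexive (trans (sym ≡-at) (+-comm (x pos) _))))

    r+prev≡a∸x[pos] : r + prev y pos ≡ a ∸ x pos
    r+prev≡a∸x[pos] = trans (cong (_+_ r) (prev-remove₂ pos x))
                            (m∸[n+o]+n≡m∸o (prev x pos) (x pos) (pairSum⁻≤ bounded pos))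

  x≗state : x ≗ state a y pos r
  x≗state i with position pos i
  ... | before i<pos = sym (trans (insert₂-< y i<pos) (remove₂-< x i<pos))
  ... | focus        = sym (begin
    state a y pos r pos    ≡⟨ insert₂-focus pos y ⟩
    a ∸ (r + prev y pos)   ≡⟨ cong (a ∸_) r+prev≡a∸x[pos] ⟩
    a ∸ (a ∸ x pos)        ≡⟨ m∸[m∸n]≡n x[pos]≤a ⟩
    x pos                  ∎)
    where open ≡-Reasoning
  ... | next         = sym (begin
    state a y pos r (suc pos)  ≡⟨ insert₂-next pos y ⟩
    r + prev y pos             ≡⟨ r+prev≡a∸x[pos] ⟩
    a ∸ x pos                  ≡⟨ cong (_∸ x pos) ≡-at ⟨
    x pos + x (suc pos) ∸ x pos ≡⟨ m+n∸m≡n (x pos) _ ⟩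
    x (suc pos)                ∎)
    where open ≡-Reasoning
  ... | after pos≤j  = sym (trans (insert₂-> y pos≤j) (remove₂-≥ x pos≤j))

  r≤slack : r ≤ slack a y pos
  r≤slack = ∸-monoʳ-≤ a (+-mono-≤ (≤-reflexive (prev-remove₂ pos x))
                                  (≤-trans (≤-reflexive (remove₂-≥ x ≤-refl)) x[2+pos]≤x[pos]))

  canonical : Canonical pos r
  canonical = canonical-slack pos <-before
    where
    canonical-slack : ∀ q → (∀ i → i < q → pairSum x i < a) → Canonical q (slack a x q)
    canonical-slack zero    _ with 1 ≤? slack a x 0
    ... | yes 1≤r = inj₁ 1≤r
    ... | no  1≰r = inj₂ (refl , n<1⇒n≡0 (≰⇒> 1≰r))
    canonical-slack (suc q) <a-before = inj₁ (m<n⇒0<n∸m (<a-before q (n<1+n q)))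

  motions-y : motionsTo a y pos + r ≡ m
  motions-y = trans (cong (_+ r) (motionsTo-local pos (λ i → remove₂-< x))) motions

  pairSum-y≤ : ∀ i → i < pos → pairSum y i ≤ pairSum x i
  pairSum-y≤ i i<pos with m≤n⇒m<n∨m≡n i<pos
  ... | inj₁ 1+i<pos = ≤-reflexive (cong₂ _+_ (remove₂-< x i<pos) (remove₂-< x 1+i<pos))
  ... | inj₂ refl    = +-mono-≤ (≤-reflexive (remove₂-< x i<pos))
                                (≤-trans (≤-reflexive (remove₂-≥ x ≤-refl)) x[2+pos]≤x[pos])

  bounded-y : Bounded a y
  bounded-y i with i <? pos
  ... | yes i<pos = ≤-trans (pairSum-y≤ i i<pos) (<⇒≤ (<-before i i<pos))
  ... | no  i≮pos = subst (_≤ a) (sym (cong₂ _+_ (remove₂-≥ x pos≤i) (remove₂-≥ x (m≤n⇒m≤1+n pos≤i))))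
                          (bounded (suc (suc i)))
    where pos≤i = ≮⇒≥ i≮pos

  precedes : ∀ {L} → Valid a L → Builds L y → Precedes (a , m) L
  precedes []                         (empty _) = tt
  precedes V@(cons {m = m′} _ a′≤a _ _) B with m≤n⇒m<n∨m≡n a′≤a
  ... | inj₁ a′<a = inj₁ a′<a
  ... | inj₂ refl = inj₂ (refl , m≤m′)
    where
    pk′ = builds-peak V B
    pos≤pos′ : pos ≤ Peak.pos pk′
    pos≤pos′ with Peak.pos pk′ <? pos
    ... | no  pos′≮pos = ≮⇒≥ pos′≮pos
    ... | yes pos′<pos = ⊥-elim (<-irrefl (Peak.≡-at pk′)
                                 (≤-<-trans (pairSum-y≤ _ pos′<pos) (<-before _ pos′<pos)))
    m≤m′ : m ≤ m′
    m≤m′ = begin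
      m                                  ≡⟨ motions-y ⟨
      motionsTo a y pos + r              ≤⟨ +-monoʳ-≤ (motionsTo a y pos) r≤slack ⟩
      motionsTo a y (suc pos)            ≤⟨ motionsTo-mono (s≤s pos≤pos′) ⟩
      motionsTo a y (suc (Peak.pos pk′)) ≡⟨ Peak.motions pk′ ⟩
      m′                                 ∎
      where open ≤-Reasoning

decompose : ∀ N {K x} → ZeroFrom N x → Bounded K x → ∃ λ L → Valid K L × Builds L x
decompose zero    zero-x _ = [] , [] , empty (λ i → zero-x i z≤n)
decompose (suc N) {K} {x} zero-x Bx with leftmostMax (pairSum x) N
... | P , P≤N , <P , ≤P = split (1 ≤? pairSum x P)
  where
  a : ℕ
  a = pairSum x P

  maximal : Bounded a x
  maximal i with i ≤? N
  ... | yes i≤N = ≤P i i≤N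
  ... | no  i≰N = subst (_≤ a) (sym (cong₂ _+_ (zero-x i N<i) (zero-x (suc i) (m≤n⇒m≤1+n N<i)))) z≤n
    where N<i = ≰⇒> i≰N

  pk : Peak a (motionsTo a x (suc P)) x
  pk = record { bounded = maximal ; pos = P ; <-before = <P ; ≡-at = refl ; motions = refl }

  split : Dec (1 ≤ a) → ∃ λ L → Valid K L × Builds L x
  split (no 1≰a)  =
    [] , [] , empty (λ i → n≤0⇒n≡0 (≤-trans (m≤m+n (x i) _) (≤-trans (maximal i) (≮⇒≥ 1≰a))))
  split (yes 1≤a) with decompose N (remove₂-zeroFrom P≤N zero-x) bounded-y
    where open Peel pk
  ... | L , V , B = (a , _) ∷ L , cons 1≤a (Bx P) V (precedes V B) ,
                    insert P r B r≤slack canonical motions-y x≗state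
    where open Peel pk

-- Tuples of partitions as lists of entries

Linked-reverse : ∀ {A : Set} {R : A → A → Set} {xs} → Linked R xs → Linked (flip R) (reverse xs)
Linked-reverse []                = []
Linked-reverse {xs = x ∷ xs} Rxs = go [-] Rxs
  where
  go : ∀ {A : Set} {R : A → A → Set} {x acc xs} → Linked (flip R) (x ∷ acc) → Linked R (x ∷ xs) →
       Linked (flip R) (reverseAcc (x ∷ acc) xs)
  go acc [-]         = acc
  go acc (Rxy ∷ Rys) = go (Rxy ∷ acc) Rys

Valid-weaken : ∀ {a K L} → a ≤ K → Valid a L → Valid K L
Valid-weaken a≤K []                      = []
Valid-weaken a≤K (cons 1≤b b≤a V prec) = cons 1≤b (≤-trans b≤a a≤K) V prec

Valid-positive : ∀ {K L} → Valid K L → All (λ e → 1 ≤ proj₁ e) L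
Valid-positive []                 = []
Valid-positive (cons 1≤a _ V _) = 1≤a ∷ Valid-positive V

Valid-++ : ∀ {K c A B} → Valid K A → All (λ e → c < proj₁ e) A → Valid c B → c ≤ K → Valid K (A ++ B)
Valid-++ []                           []          VB c≤K = Valid-weaken c≤K VB
Valid-++ {A = (a , m) ∷ A} (cons 1≤a a≤K VA prec) (c<a ∷ cs) VB c≤K =
  cons 1≤a a≤K (Valid-++ VA cs VB (<⇒≤ c<a)) (precedes-++ A prec VB)
  where
  precedes-++ : ∀ A {B} → Precedes (a , m) A → Valid _ B → Precedes (a , m) (A ++ B)
  precedes-++ []      _    []                  = tt
  precedes-++ []      _    (cons _ b≤c _ _) = inj₁ (≤-<-trans b≤c c<a)
  precedes-++ (_ ∷ _) prec _                   = prec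

block : ℕ → List ℕ → List Entry
block c = map (c ,_)

block-valid : ∀ {c w} → 1 ≤ c → Linked _≤_ w → Valid c (block c w)
block-valid 1≤c []           = []
block-valid 1≤c [-]          = cons 1≤c ≤-refl [] tt
block-valid 1≤c (m≤m′ ∷ l) = cons 1≤c ≤-refl (block-valid 1≤c l) (inj₂ (refl , m≤m′))

labelled : ∀ {n} → ℕ → Vec (List ℕ) n → List Entry
labelled j []       = []
labelled j (x ∷ xs) = labelled (suc j) xs ++ block (suc j) (reverse x)

frames : List Entry → List ℕ
frames []            = []
frames ((a , _) ∷ L) = a ∷ 0 ∷ frames L

frames-++ : ∀ A B → frames (A ++ B) ≡ frames A ++ frames B
frames-++ []            B = refl
frames-++ ((a , _) ∷ A) B = cong (λ F → a ∷ 0 ∷ F) (frames-++ A B)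

frames-block : ∀ c w → frames (block c w) ≡ pairs c (length w)
frames-block c []      = refl
frames-block c (_ ∷ w) = cong (λ F → c ∷ 0 ∷ F) (frames-block c w)

frames-labelled : ∀ {n} j (ls : Vec (List ℕ) n) → frames (labelled j ls) ≡ frameListFrom j ls
frames-labelled j []       = refl
frames-labelled j (x ∷ xs) = begin
  frames (labelled (suc j) xs ++ block (suc j) (reverse x))
    ≡⟨ frames-++ (labelled (suc j) xs) _ ⟩
  frames (labelled (suc j) xs) ++ frames (block (suc j) (reverse x))
    ≡⟨ cong₂ _++_ (frames-labelled (suc j) xs) (frames-block (suc j) (reverse x)) ⟩
  frameListFrom (suc j) xs ++ pairs (suc j) (length (reverse x))
    ≡⟨ cong (λ l → frameListFrom (suc j) xs ++ pairs (suc j) l) (length-reverse x) ⟩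
  frameListFrom (suc j) xs ++ pairs (suc j) (length x) ∎
  where open ≡-Reasoning

motions-labelled : ∀ {n} j (ls : Vec (List ℕ) n) →
                   map proj₂ (labelled j ls) ≡ reverse (concat (toList ls))
motions-labelled j []       = refl
motions-labelled j (x ∷ xs) = begin
  map proj₂ (labelled (suc j) xs ++ block (suc j) (reverse x))
    ≡⟨ map-++ proj₂ (labelled (suc j) xs) _ ⟩
  map proj₂ (labelled (suc j) xs) ++ map proj₂ (block (suc j) (reverse x))
    ≡⟨ cong₂ _++_ (motions-labelled (suc j) xs) (trans (sym (map-∘ (reverse x))) (map-id (reverse x))) ⟩
  reverse (concat (toList xs)) ++ reverse x
    ≡⟨ reverse-++ x (concat (toList xs)) ⟨
  reverse (x ++ concat (toList xs)) ∎
  where open ≡-Reasoning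

labelled-above : ∀ {n} j (ls : Vec (List ℕ) n) → All (λ e → j < proj₁ e) (labelled j ls)
labelled-above j []       = []
labelled-above j (x ∷ xs) =
  All.++⁺ (All.map <⇒≤ (labelled-above (suc j) xs))
          (All.map⁺ (All.universal (λ _ → ≤-refl) (reverse x)))

labelled-valid : ∀ {n} j {ls : Vec (List ℕ) n} → VAll IsPartition ls → Valid (j + n) (labelled j ls)
labelled-valid j                 []         = []
labelled-valid j {ls = x ∷ xs} (px ∷ pxs) =
  Valid-++ (subst (λ K → Valid K (labelled (suc j) xs)) (sym (+-suc j _)) (labelled-valid (suc j) pxs))
           (labelled-above (suc j) xs)
           (block-valid (s≤s z≤n) (Linked-reverse px))
           (≤-trans (s≤s (m≤m+n j _)) (≤-reflexive (sym (+-suc j _))))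

++-block-injective : ∀ {c A A′ w w′} → All (λ e → c < proj₁ e) A → All (λ e → c < proj₁ e) A′ →
                     A ++ block c w ≡ A′ ++ block c w′ → A ≡ A′ × w ≡ w′
++-block-injective                 []         []          eq = refl , map-injective ,-injectiveʳ eq
++-block-injective {w = []}        []         (_ ∷ _)     ()
++-block-injective {w = _ ∷ _}     []         (c<a′ ∷ _)  eq =
  ⊥-elim (<-irrefl (cong proj₁ (proj₁ (∷-injective eq))) c<a′)
++-block-injective {w′ = []}       (_ ∷ _)    []          ()
++-block-injective {w′ = _ ∷ _}    (c<a ∷ _)  []          eq =
  ⊥-elim (<-irrefl (cong proj₁ (sym (proj₁ (∷-injective eq)))) c<a)
++-block-injective                 (_ ∷ cs)   (_ ∷ cs′)   eq with ∷-injective eq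
... | e≡e′ , eq′ with ++-block-injective cs cs′ eq′
... | A≡A′ , w≡w′ = cong₂ _∷_ e≡e′ A≡A′ , w≡w′

labelled-injective : ∀ {n} j (ls ls′ : Vec (List ℕ) n) → labelled j ls ≡ labelled j ls′ → ls ≡ ls′
labelled-injective j []       []         _  = refl
labelled-injective j (x ∷ xs) (x′ ∷ xs′) eq
  with ++-block-injective (labelled-above (suc j) xs) (labelled-above (suc j) xs′) eq
... | xs-eq , x-eq = cong₂ _∷_ (reverse-injective x-eq) (labelled-injective (suc j) xs xs′ xs-eq)

split-lowest : ∀ {K c L} → Valid K L → All (λ e → c ≤ proj₁ e) L →
               ∃₂ λ A w → A ++ block c w ≡ L × Valid K A × All (λ e → c < proj₁ e) A × Linked _≤_ w
split-lowest []                        [] = [] , [] , refl , [] , [] , []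
split-lowest (cons {a} {m} 1≤a a≤K V prec) (c≤a ∷ cs) with split-lowest V cs | m≤n⇒m<n∨m≡n c≤a
... | A , w , refl , VA , colours , lw | inj₁ c<a =
  (a , m) ∷ A , w , refl , cons 1≤a a≤K VA (prefix A prec) , c<a ∷ colours , lw
  where
  prefix : ∀ A {B} → Precedes (a , m) (A ++ B) → Precedes (a , m) A
  prefix []      _    = tt
  prefix (_ ∷ _) prec = prec
... | [] , w , refl , _ , _ , lw | inj₂ refl = [] , m ∷ w , refl , [] , [] , head-linked w prec lw
  where
  head-linked : ∀ w → Precedes (a , m) (block a w) → Linked _≤_ w → Linked _≤_ (m ∷ w)
  head-linked []      _                   _  = [-]
  head-linked (_ ∷ _) (inj₁ a<a)          _  = ⊥-elim (<-irrefl refl a<a)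
  head-linked (_ ∷ _) (inj₂ (_ , m≤m′)) lw = m≤m′ ∷ lw
... | _ ∷ _ , _ , _ , cons _ a′≤a _ _ , a<a′ ∷ _ , _ | inj₂ refl = ⊥-elim (<⇒≱ a<a′ a′≤a)

labelled-surjective : ∀ n j {L} → Valid (j + n) L → All (λ e → j < proj₁ e) L →
                      ∃ λ (ls : Vec (List ℕ) n) → VAll IsPartition ls × labelled j ls ≡ L
labelled-surjective zero    j []                       []          = [] , [] , refl
labelled-surjective zero    j (cons _ a≤j+0 _ _)     (j<a ∷ _)  =
  ⊥-elim (<⇒≱ j<a (≤-trans a≤j+0 (≤-reflexive (+-identityʳ j))))
labelled-surjective (suc n) j V colours with split-lowest V colours
... | A , w , refl , VA , colours-A , lw
  with labelled-surjective n (suc j) (subst (λ K → Valid K A) (+-suc j n) VA) colours-A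
... | ls , partitions , refl =
  reverse w ∷ ls , Linked-reverse lw ∷ partitions ,
  cong (λ v → labelled (suc j) ls ++ block (suc j) v) (reverse-involutive w)

-- The bijection

realise : ∀ {K L x} u {f} → Valid K L → Builds L x → restrict u f ≗ at (frames L) →
          ∃ λ g → ApplyAll u (map proj₂ L) f g × restrict u g ≗ x × (∀ i → i ℤ.< u → g i ≡ f i)
realise u {f} [] (empty x≡0) f≗ = f , aa-nil , (λ n → trans (f≗ n) (sym (x≡0 n))) , λ _ _ → refl
realise u {f} (cons _ _ V _) (insert {a} {y = y} p r B r≤ canon refl x≗) f≗
  with realise (u ℤ.+ + 2) V B (λ n → trans (cong f (ℤ.+-assoc u (+ 2) (+ n))) (f≗ (2 + n)))
... | g , A , g≗y , g≡f with Simulation.simulate (builds-bounded V B) u (run-to r≤ canon) z≤n g≗start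
  where
  g≗start : restrict u g ≗ state a y 0 0
  g≗start zero          = trans (g≡f _ (ℤ.+-monoʳ-< u (ℤ.+<+ (s≤s z≤n)))) (f≗ 0)
  g≗start (suc zero)    = trans (g≡f _ (ℤ.+-monoʳ-< u (ℤ.+<+ (s≤s (s≤s z≤n))))) (f≗ 1)
  g≗start (suc (suc n)) = trans (cong g (sym (ℤ.+-assoc u (+ 2) (+ n)))) (g≗y n)
... | h , P , h≗ =
  h , aa-cons A (subst (λ w → PM w _ g h) (ℤ.+-identityʳ u) P) , (λ n → trans (h≗ n) (sym (x≗ n))) ,
  λ i i<u → trans (PM-below P i (subst (i ℤ.<_) (sym (ℤ.+-identityʳ u)) i<u))
                  (g≡f i (ℤ.<-trans i<u (u<u+[1+n] u 1)))

fs-offset : ∀ {k} u (ls : Tuple k) → restrict u (fs u ls) ≗ at (frames (labelled 0 ls))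
fs-offset u ls n with (u ℤ.+ + n) ℤ.- u | [u+i]-u≡i u (+ n)
... | .(+ n) | refl = cong (λ l → at l n) (sym (frames-labelled 0 ls))

fs-below : ∀ {k} u (ls : Tuple k) i → i ℤ.< u → fs u ls i ≡ 0
fs-below u ls i i<u with i ℤ.- u | u+[i-u]≡i u i
... | + n      | eq = ⊥-elim (below⇒≢offset n i<u (sym eq))
... | -[1+ _ ] | _  = refl

module _ {k : ℕ} (u : ℤ) {ls : Tuple k} (tuple : IsTuple ls) where

  labelled-tuple-valid : Valid k (labelled 0 ls)
  labelled-tuple-valid = labelled-valid 0 tuple

  builds⇒ΛRel : ∀ {x} → Builds (labelled 0 ls) x →
                ∃ λ g → ΛRel u ls g × restrict u g ≗ x × (∀ i → i ℤ.< u → g i ≡ 0)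
  builds⇒ΛRel B with realise u labelled-tuple-valid B (fs-offset u ls)
  ... | g , A , g≗x , g≡fs =
    g , subst (λ l → ApplyAll u l (fs u ls) g) (motions-labelled 0 ls) A , g≗x ,
    λ i i<u → trans (g≡fs i i<u) (fs-below u ls i i<u)

  ΛRel⇒builds : ∀ {g} → ΛRel u ls g → ∃ λ x → Builds (labelled 0 ls) x × restrict u g ≗ x
  ΛRel⇒builds Λ with builds-exists labelled-tuple-valid
  ... | x , B with builds⇒ΛRel B
  ... | g′ , Λ′ , g′≗x , _ with ApplyAll-deterministic Λ Λ′
  ... | refl = x , B , g′≗x

InA-from-restrict : ∀ {k u g x N} → restrict u g ≗ x → (∀ i → i ℤ.< u → g i ≡ 0) →
                    Bounded k x → ZeroFrom N x → InA k u g
InA-from-restrict {k} {u} {g} {x} {N} g≗x g≡0 Bx zero-x = (ℤ.∣ u ∣ + N , finite) , pairSums≤ , g≡0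
  where
  finite : ∀ i → ℤ.∣ u ∣ + N ≤ ℤ.∣ i ∣ → g i ≡ 0
  finite i ∣u∣+N≤∣i∣ with offset u i
  ... | below i<u = g≡0 i i<u
  ... | from n    =
    trans (g≗x n) (zero-x n (+-cancelˡ-≤ ℤ.∣ u ∣ N n (≤-trans ∣u∣+N≤∣i∣ (ℤ.∣i+j∣≤∣i∣+∣j∣ u (+ n)))))

  g≤k : ∀ i → g i ≤ k
  g≤k i with offset u i
  ... | below i<u = subst (_≤ k) (sym (g≡0 i i<u)) z≤n
  ... | from n    = subst (_≤ k) (sym (g≗x n)) (≤-trans (m≤m+n _ _) (Bx n))

  pairSums≤ : ∀ i → g i + g (i ℤ.+ + 1) ≤ k
  pairSums≤ i with offset u i
  ... | below i<u = subst (λ v → v + g (i ℤ.+ + 1) ≤ k) (sym (g≡0 i i<u)) (g≤k _)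
  ... | from n    =
    subst (_≤ k) (sym (cong₂ _+_ (g≗x n) (trans (cong g ([u+n]+k≡u+[k+n] u n 1)) (g≗x (suc n))))) (Bx n)

finiteSupport⇒zeroFrom : ∀ u {f} → FiniteSupport f → ∃ λ N → ZeroFrom N (restrict u f)
finiteSupport⇒zeroFrom u {f} (M , zero-f) = M + ℤ.∣ u ∣ , λ n M+∣u∣≤n →
  zero-f (u ℤ.+ + n) (+-cancelʳ-≤ ℤ.∣ u ∣ M _ (≤-trans M+∣u∣≤n (n≤ n)))
  where
  n≤ : ∀ n → n ≤ ℤ.∣ u ℤ.+ + n ∣ + ℤ.∣ u ∣
  n≤ n = subst (_≤ ℤ.∣ u ℤ.+ + n ∣ + ℤ.∣ u ∣) (cong ℤ.∣_∣ ([u+i]-u≡i u (+ n)))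
               (ℤ.∣i-j∣≤∣i∣+∣j∣ (u ℤ.+ + n) u)

module _ (u : ℤ) (k : ℕ) where

  Λ-total : (ls : Tuple k) → IsTuple ls → ∃ λ (g : Seq) → ΛRel u ls g × InA k u g
  Λ-total ls tuple with builds-exists (labelled-tuple-valid u tuple)
  ... | x , B with builds⇒ΛRel u tuple B
  ... | g , Λ , g≗x , g≡0 =
    g , Λ , InA-from-restrict g≗x g≡0 (builds-bounded (labelled-tuple-valid u tuple) B)
                              (proj₂ (builds-zeroFrom B))

  Λ-injective : (ls ls′ : Tuple k) → IsTuple ls → IsTuple ls′ → (g g′ : Seq) →
                ΛRel u ls g → ΛRel u ls′ g′ → g ≗ˢ g′ → ls ≡ ls′
  Λ-injective ls ls′ tuple tuple′ g g′ Λ Λ′ g≗g′ with ΛRel⇒builds u tuple Λ | ΛRel⇒builds u tuple′ Λ′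
  ... | x , B , g≗x | x′ , B′ , g′≗x′ =
    labelled-injective 0 ls ls′
      (builds-injective (labelled-tuple-valid u tuple) (labelled-tuple-valid u tuple′) B B′
                        (λ n → trans (sym (g≗x n)) (trans (g≗g′ _) (g′≗x′ n))))

  Λ-surjective : (f : Seq) → InA k u f →
                 ∃ λ (ls : Tuple k) → IsTuple ls × ∃ λ (g : Seq) → ΛRel u ls g × g ≗ˢ f
  Λ-surjective f (finite , pairSums≤ , f≡0) with finiteSupport⇒zeroFrom u finite
  ... | N , zero-x with decompose N zero-x bounded
    where
    bounded : Bounded k (restrict u f)
    bounded n = subst (λ v → f (u ℤ.+ + n) + f v ≤ k) ([u+n]+k≡u+[k+n] u n 1) (pairSums≤ (u ℤ.+ + n))
  ... | L , V , B with labelled-surjective k 0 V (Valid-positive V)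
  ... | ls , tuple , refl with builds⇒ΛRel u tuple B
  ... | g , Λ , g≗f , g≡0 =
    ls , tuple , g , Λ , ≗-from-restrict g≗f (λ i i<u → trans (g≡0 i i<u) (sym (f≡0 i i<u)))

theorem2p5 : (u : ℤ) (k : ℕ) → 1 ≤ k →
    ((ls : Tuple k) → IsTuple ls → ∃ λ (g : Seq) → ΛRel u ls g × InA k u g)
    × ((ls ls′ : Tuple k) → IsTuple ls → IsTuple ls′ → (g g′ : Seq) →
         ΛRel u ls g → ΛRel u ls′ g′ → g ≗ˢ g′ → ls ≡ ls′)
    × ((f : Seq) → InA k u f →
         ∃ λ (ls : Tuple k) → IsTuple ls × ∃ λ (g : Seq) → ΛRel u ls g × g ≗ˢ f)
theorem2p5 u k _ = Λ-total u k , Λ-injective u k , Λ-surjective u k
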